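{- There exist an $\omega$-power-free infinite word $x$ over an infinite alphabet and an integer $k\in\mathbb{N}$ such that $\mathrm{AP}(x,k)$ is empty.
   Context: A factor of a word is a contiguous subword. A word is $\omega$-power-free if for every finite nonempty factor $u$ there exists $\ell\in\mathbb{N}$ such that $u^\ell$ ($u$ concatenated $\ell$ times) is not a factor. A $k$-anti-power is a word $w=w_1\cdots w_k$ with $|w_1|=\cdots=|w_k|$ and $w_1,\dots,w_k$ pairwise distinct. $\mathrm{AP}(x,k)$ is the set of $m\in\mathbb{N}=\{1,2,\dots\}$ such that the prefix of $x$ of length $km$ is a $k$-anti-power. -}

module Defs where

open import Data.Nat using (ℕ; zero; suc; _+_; _*_; _<_; _≤_)
open import Data.List using (List; []; _∷_; _++_; length; map; upTo; take; drop)
open import Data.Product using (Σ; ∃; _×_)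
open import Relation.Binary.PropositionalEquality using (_≡_; _≢_)
open import Relation.Nullary using (¬_)

Word : Set
Word = ℕ → ℕ

factorAt : Word → ℕ → ℕ → List ℕ
factorAt x i n = map (λ t → x (i + t)) (upTo n)

IsFactor : List ℕ → Word → Set
IsFactor u x = ∃ λ i → factorAt x i (length u) ≡ u

pow : List ℕ → ℕ → List ℕ
pow u zero = []
pow u (suc ℓ) = u ++ pow u ℓ

OmegaPowerFree : Word → Set
OmegaPowerFree x = (u : List ℕ) → 1 ≤ length u → IsFactor u x →
  ∃ λ ℓ → 1 ≤ ℓ × ¬ IsFactor (pow u ℓ) x

IsAntiPower : ℕ → List ℕ → Set
IsAntiPower k w = Σ ℕ λ m → length w ≡ k * m ×
  ((i j : ℕ) → i < k → j < k → i ≢ j →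
     take m (drop (i * m) w) ≢ take m (drop (j * m) w))

prefix : Word → ℕ → List ℕ
prefix x n = factorAt x 0 n

-- m ∈ AP(x,k): m ∈ ℕ = {1,2,…} and the prefix of length km is a k-anti-power.
InAP : Word → ℕ → ℕ → Set
InAP x k m = 1 ≤ m × IsAntiPower k (prefix x (k * m))

APEmpty : Word → ℕ → Set
APEmpty x k = (m : ℕ) → ¬ InAP x k m

-- Over the alphabet ℕ take x n = ⌊log₂ n⌋. Each letter h occurs only at
-- positions below 2^(h+1), so a factor u^ℓ starting with h can only occur
-- when ℓ·|u| < 2^(h+1): x is ω-power-free. On the other hand x is constant
-- on [2^d, 2^(d+1)); for block length m and d = ⌊log₂ m⌋ + 3 this run has
-- length between 3m and 8m, so it contains two consecutive whole blocks of
-- length m among the first 11, and no prefix of length 11m is an 11-anti-power.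
module Submission where

open import Defs
open import Data.Nat using (ℕ; zero; suc; _+_; _*_; _∸_; _^_; _≤_; _<_; z≤n; s≤s; s≤s⁻¹; NonZero; ⌊_/2⌋; ⌈_/2⌉)
open import Data.Nat.Properties
open import Data.Nat.Logarithm using (⌊log₂_⌋; ⌊log₂⌋-mono-≤; ⌊log₂⌊n/2⌋⌋≡⌊log₂n⌋∸1; ⌊log₂[2^n]⌋≡n)
open import Data.Nat.DivMod using (_/_; m≡m%n+[m/n]*n; m%n<n; m/n*n≤m; m<n*o⇒m/o<n)
open import Data.List using (List; []; _∷_; _++_; length; take; drop; replicate; applyUpTo)
open import Data.List.Properties using (length-++; ++-assoc; ++-identityʳ; ∷-injectiveˡ; ∷-injectiveʳ; map-upTo)
open import Data.Product using (∃; _×_; _,_; proj₁; proj₂)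
open import Relation.Binary.PropositionalEquality
open import Relation.Nullary using (¬_)
open import Function using (_∘_)

slice : Word → ℕ → ℕ → List ℕ
slice w j zero    = []
slice w j (suc n) = w j ∷ slice w (suc j) n

applyUpTo≗slice : ∀ (w : Word) (f : ℕ → ℕ) j n → (∀ t → f t ≡ w (j + t)) →
                  applyUpTo f n ≡ slice w j n
applyUpTo≗slice w f j zero    f≗w = refl
applyUpTo≗slice w f j (suc n) f≗w =
  cong₂ _∷_ (trans (f≗w 0) (cong w (+-identityʳ j)))
            (applyUpTo≗slice w (λ t → f (suc t)) (suc j) n
              (λ t → trans (f≗w (suc t)) (cong w (+-suc j t))))

factorAt≡slice : ∀ (w : Word) j n → factorAt w j n ≡ slice w j n
factorAt≡slice w j n =
  trans (map-upTo (λ t → w (j + t)) n) (applyUpTo≗slice w (λ t → w (j + t)) j n (λ _ → refl))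

length-slice : ∀ (w : Word) j n → length (slice w j n) ≡ n
length-slice w j zero    = refl
length-slice w j (suc n) = cong suc (length-slice w (suc j) n)

drop-slice : ∀ (w : Word) j a n → drop a (slice w j n) ≡ slice w (j + a) (n ∸ a)
drop-slice w j zero    n       = cong (λ i → slice w i n) (sym (+-identityʳ j))
drop-slice w j (suc a) zero    = refl
drop-slice w j (suc a) (suc n) =
  trans (drop-slice w (suc j) a n) (cong (λ i → slice w i (n ∸ a)) (sym (+-suc j a)))

take-slice : ∀ (w : Word) j b n → b ≤ n → take b (slice w j n) ≡ slice w j b
take-slice w j zero    n       b≤n       = refl
take-slice w j (suc b) (suc n) (s≤s b≤n) = cong (w j ∷_) (take-slice w (suc j) b n b≤n)

slice-at : ∀ (w : Word) j xs h ys → slice w j (length (xs ++ h ∷ ys)) ≡ xs ++ h ∷ ys →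
           w (j + length xs) ≡ h
slice-at w j []       h ys eq = trans (cong w (+-identityʳ j)) (∷-injectiveˡ eq)
slice-at w j (a ∷ xs) h ys eq =
  trans (cong w (+-suc j (length xs))) (slice-at w (suc j) xs h ys (∷-injectiveʳ eq))

pow-suc : ∀ u ℓ → pow u (suc ℓ) ≡ pow u ℓ ++ u
pow-suc u zero    = ++-identityʳ u
pow-suc u (suc ℓ) = trans (cong (u ++_) (pow-suc u ℓ)) (sym (++-assoc u (pow u ℓ) u))

length-pow : ∀ u ℓ → length (pow u ℓ) ≡ ℓ * length u
length-pow u zero    = refl
length-pow u (suc ℓ) = trans (length-++ u) (cong (length u +_) (length-pow u ℓ))

-- With ℓ = bound h, the last copy of u in u^(ℓ+1) starts at a position ≥ ℓ
-- carrying the letter h, contradicting the bound.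
boundedPositions⇒omegaPowerFree : ∀ (w : Word) (bound : ℕ → ℕ) →
                                  (∀ n → n < bound (w n)) → OmegaPowerFree w
boundedPositions⇒omegaPowerFree w bound below []      () _
boundedPositions⇒omegaPowerFree w bound below (h ∷ r) _  _ = suc ℓ , s≤s z≤n , noOccurrence
  where
  ℓ = bound h
  u = h ∷ r
  noOccurrence : ¬ IsFactor (pow u (suc ℓ)) w
  noOccurrence (j , occ) = <⇒≱ (subst (j + length (pow u ℓ) <_) (cong bound hAt) (below _)) ℓ≤
    where
    hAt : w (j + length (pow u ℓ)) ≡ h
    hAt = slice-at w j (pow u ℓ) h r
      (subst (λ v → slice w j (length v) ≡ v) (pow-suc u ℓ)
        (trans (sym (factorAt≡slice w j _)) occ))
    ℓ≤ : ℓ ≤ j + length (pow u ℓ)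
    ℓ≤ = ≤-trans (≤-trans (m≤m*n ℓ (length u)) (≤-reflexive (sym (length-pow u ℓ))))
                 (m≤n+m _ j)

ConstantOn : Word → ℕ → ℕ → ℕ → Set
ConstantOn w c lo hi = ∀ n → lo ≤ n → n < hi → w n ≡ c

slice-constantOn : ∀ {w c lo hi} j n → ConstantOn w c lo hi → lo ≤ j → j + n ≤ hi →
                   slice w j n ≡ replicate n c
slice-constantOn           j zero    const lo≤j j+n≤hi = refl
slice-constantOn {hi = hi} j (suc n) const lo≤j j+n≤hi =
  cong₂ _∷_ (const j lo≤j (<-≤-trans (m<m+n j (s≤s z≤n)) j+n≤hi))
            (slice-constantOn (suc j) n const (m≤n⇒m≤1+n lo≤j) (subst (_≤ hi) (+-suc j n) j+n≤hi))

constantOn⇒equalBlocks : ∀ {w c lo hi} i m → ConstantOn w c lo hi →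
                         lo ≤ i * m → (2 + i) * m ≤ hi →
                         slice w (i * m) m ≡ slice w (suc i * m) m
constantOn⇒equalBlocks {hi = hi} i m const lo≤ ≤hi =
  trans (slice-constantOn (i * m) m const lo≤ first≤)
        (sym (slice-constantOn (suc i * m) m const (≤-trans lo≤ (m≤n+m (i * m) m)) second≤))
  where
  first≤ : i * m + m ≤ hi
  first≤ = ≤-trans (≤-reflexive (+-comm (i * m) m)) (≤-trans (+-monoʳ-≤ m (m≤n+m (i * m) m)) ≤hi)
  second≤ : suc i * m + m ≤ hi
  second≤ = ≤-trans (≤-reflexive (+-comm (suc i * m) m)) ≤hi

length-prefix : ∀ (w : Word) n → length (prefix w n) ≡ n
length-prefix w n = trans (cong length (factorAt≡slice w 0 n)) (length-slice w 0 n)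

block-prefix : ∀ (w : Word) k m i → i < k →
               take m (drop (i * m) (prefix w (k * m))) ≡ slice w (i * m) m
block-prefix w k m i i<k = begin
  take m (drop (i * m) (prefix w (k * m)))  ≡⟨ cong (λ v → take m (drop (i * m) v)) (factorAt≡slice w 0 (k * m)) ⟩
  take m (drop (i * m) (slice w 0 (k * m))) ≡⟨ cong (take m) (drop-slice w 0 (i * m) (k * m)) ⟩
  take m (slice w (i * m) (k * m ∸ i * m))  ≡⟨ take-slice w (i * m) m _ (m+n≤o⇒m≤o∸n m (*-monoˡ-≤ m i<k)) ⟩
  slice w (i * m) m                         ∎
  where open ≡-Reasoning

equalBlocks⇒¬IsAntiPower : ∀ (w : Word) k m i → suc i < k →
                           slice w (i * m) m ≡ slice w (suc i * m) m →
                           ¬ IsAntiPower k (prefix w (k * m))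
equalBlocks⇒¬IsAntiPower w (suc k) m i 1+i<k equal (m′ , len , distinct)
  with *-cancelˡ-≡ m′ m (suc k) (trans (sym len) (length-prefix w (suc k * m)))
... | refl = distinct i (suc i) i<k 1+i<k (1+n≢n ∘ sym)
               (trans (block-prefix w (suc k) m i i<k)
                      (trans equal (sym (block-prefix w (suc k) m (suc i) 1+i<k))))
  where
  i<k : i < suc k
  i<k = <-trans (n<1+n i) 1+i<k

n<2*m⇒⌊n/2⌋<m : ∀ n m → n < 2 * m → ⌊ n /2⌋ < m
n<2*m⇒⌊n/2⌋<m n m n<2m = *-cancelˡ-< 2 ⌊ n /2⌋ m (≤-<-trans 2⌊n/2⌋≤n n<2m)
  where
  2⌊n/2⌋≤n : 2 * ⌊ n /2⌋ ≤ n
  2⌊n/2⌋≤n = begin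
    2 * ⌊ n /2⌋          ≡⟨ cong (⌊ n /2⌋ +_) (+-identityʳ ⌊ n /2⌋) ⟩
    ⌊ n /2⌋ + ⌊ n /2⌋    ≤⟨ +-monoʳ-≤ ⌊ n /2⌋ (⌊n/2⌋≤⌈n/2⌉ n) ⟩
    ⌊ n /2⌋ + ⌈ n /2⌉    ≡⟨ ⌊n/2⌋+⌈n/2⌉≡n n ⟩
    n                    ∎
    where open ≤-Reasoning

n<2^[1+c]⇒⌊log₂n⌋≤c : ∀ c n → n < 2 ^ suc c → ⌊log₂ n ⌋ ≤ c
n<2^[1+c]⇒⌊log₂n⌋≤c zero    n n<2 = ≤-trans (⌊log₂⌋-mono-≤ (s≤s⁻¹ n<2)) (≤-reflexive (⌊log₂[2^n]⌋≡n 0))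
n<2^[1+c]⇒⌊log₂n⌋≤c (suc c) n n<2^[2+c] = ≤-trans (m≤n+m∸n ⌊log₂ n ⌋ 1) (s≤s ⌊log₂n⌋∸1≤c)
  where
  ⌊log₂n⌋∸1≤c : ⌊log₂ n ⌋ ∸ 1 ≤ c
  ⌊log₂n⌋∸1≤c = subst (_≤ c) (⌊log₂⌊n/2⌋⌋≡⌊log₂n⌋∸1 n)
    (n<2^[1+c]⇒⌊log₂n⌋≤c c ⌊ n /2⌋ (n<2*m⇒⌊n/2⌋<m n (2 ^ suc c) n<2^[2+c]))

n<2^[1+⌊log₂n⌋] : ∀ n → n < 2 ^ suc ⌊log₂ n ⌋
n<2^[1+⌊log₂n⌋] n = ≰⇒> λ 2^[1+⌊log₂n⌋]≤n →
  1+n≰n (subst (_≤ ⌊log₂ n ⌋) (⌊log₂[2^n]⌋≡n (suc ⌊log₂ n ⌋)) (⌊log₂⌋-mono-≤ 2^[1+⌊log₂n⌋]≤n))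

2^⌊log₂n⌋≤n : ∀ n → 1 ≤ n → 2 ^ ⌊log₂ n ⌋ ≤ n
2^⌊log₂n⌋≤n n 1≤n with ⌊log₂ n ⌋ in eq
... | zero  = 1≤n
... | suc c = ≮⇒≥ λ n<2^[1+c] →
  1+n≰n (subst (_≤ c) eq (n<2^[1+c]⇒⌊log₂n⌋≤c c n n<2^[1+c]))

⌊log₂⌋-constantOn : ∀ d → ConstantOn ⌊log₂_⌋ d (2 ^ d) (2 ^ suc d)
⌊log₂⌋-constantOn d n 2^d≤n n<2^[1+d] =
  ≤-antisym (n<2^[1+c]⇒⌊log₂n⌋≤c d n n<2^[1+d])
            (subst (_≤ ⌊log₂ n ⌋) (⌊log₂[2^n]⌋≡n d) (⌊log₂⌋-mono-≤ 2^d≤n))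

twoBlocksWithin : ∀ a m .{{_ : NonZero m}} → a ≤ suc (a / m) * m × (3 + a / m) * m ≤ 3 * m + a
twoBlocksWithin a m = a≤ , ≤a+3m
  where
  a≤ : a ≤ suc (a / m) * m
  a≤ = ≤-trans (≤-reflexive (m≡m%n+[m/n]*n a m)) (+-monoˡ-≤ (a / m * m) (<⇒≤ (m%n<n a m)))
  ≤a+3m : (3 + a / m) * m ≤ 3 * m + a
  ≤a+3m = ≤-trans (≤-reflexive (*-distribʳ-+ m 3 (a / m))) (+-monoʳ-≤ (3 * m) (m/n*n≤m a m))

-- The two blocks lie in the run [2^d, 2^(d+1)) of the letter d = ⌊log₂ m⌋ + 3;
-- the first has index 2^d / m + 1, at most 9 because 2^d ≤ 8m.
⌊log₂⌋-equalBlocks : ∀ m → 1 ≤ m →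
  ∃ λ i → suc i < 11 × slice ⌊log₂_⌋ (i * m) m ≡ slice ⌊log₂_⌋ (suc i * m) m
⌊log₂⌋-equalBlocks m@(suc _) _ =
  suc q , s≤s (s≤s q<9) ,
  constantOn⇒equalBlocks (suc q) m (⌊log₂⌋-constantOn d) lo≤ (≤-trans ≤3m+P 3m+P≤2P)
  where
  c = ⌊log₂ m ⌋
  d = 3 + c
  P = 2 ^ d
  q = P / m
  lo≤ : P ≤ suc q * m
  lo≤ = proj₁ (twoBlocksWithin P m)
  ≤3m+P : (3 + q) * m ≤ 3 * m + P
  ≤3m+P = proj₂ (twoBlocksWithin P m)
  3m≤P : 3 * m ≤ P
  3m≤P = begin
    3 * m              ≤⟨ *-monoʳ-≤ 3 (<⇒≤ (n<2^[1+⌊log₂n⌋] m)) ⟩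
    3 * 2 ^ suc c      ≤⟨ *-monoˡ-≤ (2 ^ suc c) (n≤1+n 3) ⟩
    4 * 2 ^ suc c      ≡⟨ *-assoc 2 2 (2 ^ suc c) ⟩
    P                  ∎
    where open ≤-Reasoning
  P≤8m : P ≤ 8 * m
  P≤8m = begin
    P                  ≡⟨ cong (2 *_) (*-assoc 2 2 (2 ^ c)) ⟨
    2 * (4 * 2 ^ c)    ≡⟨ *-assoc 2 4 (2 ^ c) ⟨
    8 * 2 ^ c          ≤⟨ *-monoʳ-≤ 8 (2^⌊log₂n⌋≤n m (s≤s z≤n)) ⟩
    8 * m              ∎
    where open ≤-Reasoning
  q<9 : q < 9
  q<9 = m<n*o⇒m/o<n (≤-<-trans P≤8m (*-monoˡ-< m (n<1+n 8)))
  3m+P≤2P : 3 * m + P ≤ 2 ^ suc d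
  3m+P≤2P = ≤-trans (+-monoˡ-≤ P 3m≤P) (≤-reflexive (cong (P +_) (sym (+-identityʳ P))))

⌊log₂⌋-APEmpty : APEmpty ⌊log₂_⌋ 11
⌊log₂⌋-APEmpty m (1≤m , antiPower) with ⌊log₂⌋-equalBlocks m 1≤m
... | i , 1+i<11 , equal = equalBlocks⇒¬IsAntiPower ⌊log₂_⌋ 11 m i 1+i<11 equal antiPower

theorem3p7 : ∃ λ (x : Word) → OmegaPowerFree x × (∃ λ (k : ℕ) → 1 ≤ k × APEmpty x k)
theorem3p7 =
  ⌊log₂_⌋ ,
  boundedPositions⇒omegaPowerFree ⌊log₂_⌋ (λ h → 2 ^ suc h) n<2^[1+⌊log₂n⌋] ,
  11 , s≤s z≤n , ⌊log₂⌋-APEmpty
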